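{- Let $\epsilon\in\{1,-1\}^n$ with $\epsilon_1=1$ and $\epsilon_n=-1$. Then $\mathcal{W}(\epsilon)=\mathcal{F}(\epsilon)$, i.e. $$\sum_{N\in\mathcal{N}(n;\epsilon)}q^{|\mathcal{E}(N)|}=\sum_{F\in\mathtt{For}(\epsilon)}q^{N(F;\bullet)+N(F;\circ)}.$$
   Context: A network on $n$ points is a set $E$ of pairs $(i,j)$ with $1\le i<j\le n$ (directed edges; $i$ a source, $j$ a sink) with no $(i,j),(j,k)\in E$, satisfying (B1): if $(i,k),(j,l)\in E$ with $i<j<k<l$ then $(j,k)\in E$. $\mathcal{N}(n;\epsilon)$ is the set of such networks in which every source $i$ has $\epsilon_i=1$ and every sink $j$ has $\epsilon_j=-1$; $\mathcal{E}(N)$ denotes the edge set of $N$, and $\mathcal{W}(\epsilon)=\sum_{N\in\mathcal{N}(n;\epsilon)}q^{|\mathcal{E}(N)|}$. Let $i_1<\dots<i_r$ be the positions of the entries $-1$ in $\epsilon$, and $\lambda(\epsilon)=(\lambda_1,\dots,\lambda_r)$ with $\lambda_t=\#\{k:\epsilon_k=1,\ k<i_{r+1-t}\}$, a Young diagram in French notation (row $t$ from the bottom has $\lambda_t$ cells, left justified). A forest is a filling of the cells of $\lambda(\epsilon)$ with each cell empty or pointed such that (F1): no pointed cell has both a pointed cell below it in its column and a pointed cell to its left in its row. $\mathtt{For}(\epsilon)$ is the set of forests. For a forest $F$, $N(F;\bullet)$ is the number of pointed cells, and $N(F;\circ)$ is the number of crossing cells, where a crossing cell is an empty cell having some pointed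 cell below it in its column and some pointed cell to its left in its row (equivalently, where the upward ray from a pointed cell and the rightward ray from another pointed cell meet at an empty cell). -}

module Defs where

open import Data.Bool.Base using (Bool; true; false; not; _∧_; _∨_; if_then_else_)
open import Data.Nat.Base using (ℕ; zero; suc; _≡ᵇ_; _<ᵇ_) renaming (_+_ to _+ℕ_)
open import Data.Fin.Base using (Fin; toℕ)
open import Data.Vec.Base using (Vec; lookup)
open import Data.List.Base using (List; []; _∷_; _++_; map; concatMap; filterᵇ; length; reverse; upTo; allFin; foldr)
open import Data.Bool.ListAction using (all; any)
open import Data.Product.Base using (_×_; _,_; proj₁; proj₂)
open import Algebra.Bundles using (CommutativeSemiring)

-- Sign vectors: ε : Vec Bool n, where  true  encodes +1 and  false  encodes -1.
-- Position k (1-based in the paper) is the Fin n element of value k-1.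

sublists : ∀ {a} {A : Set a} → List A → List (List A)
sublists [] = [] ∷ []
sublists (x ∷ xs) = sublists xs ++ map (x ∷_) (sublists xs)

Edge : ℕ → Set
Edge n = Fin n × Fin n

_<ᶠ_ : ∀ {n} → Fin n → Fin n → Bool
i <ᶠ j = toℕ i <ᵇ toℕ j

_==ᶠ_ : ∀ {n} → Fin n → Fin n → Bool
i ==ᶠ j = toℕ i ≡ᵇ toℕ j

_==ᵉ_ : ∀ {n} → Edge n → Edge n → Bool
(i , j) ==ᵉ (k , l) = (i ==ᶠ k) ∧ (j ==ᶠ l)

_∈ᵉ_ : ∀ {n} → Edge n → List (Edge n) → Bool
e ∈ᵉ E = any (e ==ᵉ_) E

allPairs : (n : ℕ) → List (Edge n)
allPairs n = concatMap (λ i → map (i ,_) (filterᵇ (i <ᶠ_) (allFin n))) (allFin n)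

noPath : ∀ {n} → List (Edge n) → Bool
noPath E = all (λ e → all (λ f → not (proj₂ e ==ᶠ proj₁ f)) E) E

condB1 : ∀ {n} → List (Edge n) → Bool
condB1 E = all (λ e → all (λ f → B1 (proj₁ e) (proj₂ e) (proj₁ f) (proj₂ f)) E) E
  where
  B1 : _ → _ → _ → _ → Bool
  B1 i k j l = if (i <ᶠ j) ∧ (j <ᶠ k) ∧ (k <ᶠ l) then ((j , k) ∈ᵉ E) else true

signCond : ∀ {n} → Vec Bool n → List (Edge n) → Bool
signCond ε E = all (λ e → lookup ε (proj₁ e) ∧ not (lookup ε (proj₂ e))) E

isNetwork : ∀ {n} → Vec Bool n → List (Edge n) → Bool
isNetwork ε E = noPath E ∧ condB1 E ∧ signCond ε E

networks : ∀ {n} → Vec Bool n → List (List (Edge n))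
networks {n} ε = filterᵇ (isNetwork ε) (sublists (allPairs n))

negPositions : ∀ {n} → Vec Bool n → List (Fin n)
negPositions {n} ε = filterᵇ (λ k → not (lookup ε k)) (allFin n)

plusBefore : ∀ {n} → Vec Bool n → Fin n → ℕ
plusBefore {n} ε i = length (filterᵇ (λ k → lookup ε k ∧ (k <ᶠ i)) (allFin n))

shape : ∀ {n} → Vec Bool n → List ℕ
shape ε = reverse (map (plusBefore ε) (negPositions ε))

Cell : Set
Cell = ℕ × ℕ   -- (row t , column c), both 1-based, row 1 at the bottom (French)

cellsFrom : ℕ → List ℕ → List Cell
cellsFrom t [] = []
cellsFrom t (l ∷ ls) = map (λ c → (t , suc c)) (upTo l) ++ cellsFrom (suc t) ls

cells : ∀ {n} → Vec Bool n → List Cell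
cells ε = cellsFrom 1 (shape ε)

_==ᶜ_ : Cell → Cell → Bool
(t , c) ==ᶜ (t' , c') = (t ≡ᵇ t') ∧ (c ≡ᵇ c')

_∈ᶜ_ : Cell → List Cell → Bool
x ∈ᶜ P = any (x ==ᶜ_) P

-- a filling is given by its list P of pointed cells
-- some pointed cell strictly below (t,c) in column c
pointedBelow : List Cell → Cell → Bool
pointedBelow P (t , c) = any (λ p → (proj₂ p ≡ᵇ c) ∧ (proj₁ p <ᵇ t)) P

pointedLeft : List Cell → Cell → Bool
pointedLeft P (t , c) = any (λ p → (proj₁ p ≡ᵇ t) ∧ (proj₂ p <ᵇ c)) P

condF1 : List Cell → Bool
condF1 P = all (λ p → not (pointedBelow P p ∧ pointedLeft P p)) P

forests : ∀ {n} → Vec Bool n → List (List Cell)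
forests ε = filterᵇ condF1 (sublists (cells ε))

nPointed : List Cell → ℕ
nPointed P = length P

nCrossing : ∀ {n} → Vec Bool n → List Cell → ℕ
nCrossing ε P =
  length (filterᵇ (λ x → not (x ∈ᶜ P) ∧ pointedBelow P x ∧ pointedLeft P x) (cells ε))

-- Generating functions, evaluated at q in an arbitrary commutative semiring
-- (identity for all such (R , q) ⇔ identity in ℕ[q]).

module _ {c ℓ} (R : CommutativeSemiring c ℓ) where
  open CommutativeSemiring R

  pow : Carrier → ℕ → Carrier
  pow q zero = 1#
  pow q (suc k) = q * pow q k

  sumR : List Carrier → Carrier
  sumR = foldr _+_ 0#

  W : ∀ {n} → Vec Bool n → Carrier → Carrier
  W ε q = sumR (map (λ E → pow q (length E)) (networks ε))

  F : ∀ {n} → Vec Bool n → Carrier → Carrier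
  F ε q = sumR (map (λ P → pow q (nPointed P +ℕ nCrossing ε P)) (forests ε))

-- An edge (i , j) of a network, with i a source and j a sink, corresponds to the cell of λ(ε) in
-- the row of j and the column of i. Under this correspondence networks are the sets E of cells
-- satisfying the image of (B1), which says that E is closed: a cell with a cell of E below it in
-- its column and a cell of E to its left in its row belongs to E. Deleting from a closed E its
-- crossed cells leaves a forest P, and adding back the crossing cells of P recovers E: walking down
-- a column (or left along a row) from a cell of E, the first uncrossed cell is kept, so the crossed
-- cells of E are exactly the crossing cells of P. Hence |E| = N(P;•) + N(P;∘), and both sides of
-- the identity are the same sum, once over networks and once over forests.

{-# OPTIONS --safe #-}
module Submission where

open import Defs
open import Level using (Level; _⊔_)
open import Function.Base using (_∘_)
open import Function.Bundles using (_⇔_; mk⇔; module Equivalence)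
open import Data.Bool.Base using (Bool; true; false; not; _∧_; _∨_; T; if_then_else_)
open import Data.Bool.Properties using (T-∧; T-∨; T-≡)
open import Data.Bool.ListAction using (all; any)
open import Data.Empty using (⊥; ⊥-elim)
open import Data.Unit.Base using (tt)
open import Data.Nat.Base
  using (ℕ; zero; suc; _≤_; _<_; z≤n; s≤s; _≡ᵇ_; _<ᵇ_) renaming (_+_ to _+ℕ_)
open import Data.Nat.Properties
  using ( ≡ᵇ⇒≡; ≡⇒≡ᵇ; <ᵇ⇒<; <⇒<ᵇ; _<?_; +-suc; +-comm; +-identityʳ; m≤n⇒m≤1+n
        ; ≤-pred; ≤-refl; ≤-trans; <-trans; ≤-<-trans; <-≤-trans; <⇒≤; <-irrefl; <-asym
        ; <-cmp; ≮⇒≥; <⇒≱; >⇒≢ )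
open import Data.Nat.Induction using (<-wellFounded)
open import Induction.WellFounded using (Acc; acc)
open import Data.Vec.Base using (Vec; lookup; head; last)
open import Data.Fin.Base using (Fin; toℕ)
open import Data.Fin.Properties using (toℕ-injective)
open import Data.Product.Base using (∃-syntax; _×_; _,_; proj₁; proj₂; map₂)
open import Data.Sum.Base using (_⊎_; inj₁; inj₂)
import Data.Sum.Base as Sum
open import Data.List.Base using (List; []; _∷_; map; filterᵇ; length; reverse; upTo; allFin)
open import Data.List.Properties
  using ( ∷-injectiveʳ; length-map; map-∘; unfold-reverse; reverse-map
        ; filter-none; filter-accept; filter-reject )
open import Data.List.Membership.Propositional using (_∈_; _∉_; find; lose)
open import Data.List.Membership.Propositional.Properties
  using ( ∈-++⁺ˡ; ∈-++⁺ʳ; ∈-++⁻; ∈-map⁺; ∈-map⁻; map∷⁻; ∈-filter⁺; ∈-filter⁻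
        ; ∈-concatMap⁺; ∈-concatMap⁻; ∈-upTo⁺; ∈-upTo⁻; ∈-allFin )
open import Data.List.Membership.Propositional.Properties.WithK using (unique∧set⇒bag)
open import Data.List.Relation.Unary.Any using (here; there)
open import Data.List.Relation.Unary.Any.Properties using (any⇔; reverse⁺; reverse⁻)
open import Data.List.Relation.Unary.All as All using (All; []; _∷_)
open import Data.List.Relation.Unary.All.Properties using (all⁺; all⁻) renaming (map⁺ to All-map⁺)
open import Data.List.Relation.Unary.AllPairs using (AllPairs; []; _∷_) renaming (map to AllPairs-map)
import Data.List.Relation.Unary.AllPairs.Properties as AllPairs
open import Data.List.Relation.Unary.Unique.Propositional using (Unique)
import Data.List.Relation.Unary.Unique.Propositional.Properties as Unique
open import Data.List.Relation.Binary.Subset.Propositional using (_⊆_)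
open import Data.List.Relation.Binary.BagAndSetEquality using (∼bag⇒↭)
open import Data.List.Relation.Binary.Permutation.Propositional using (_↭_; ↭⇒↭ₛ′)
open import Data.List.Relation.Binary.Permutation.Propositional.Properties
  using (↭-length) renaming (map⁺ to ↭-map⁺)
import Data.List.Relation.Binary.Permutation.Setoid.Properties as PermutationSetoid
open import Relation.Binary.Definitions using (tri<; tri≈; tri>)
open import Relation.Nullary.Decidable using (Dec; T?; yes; no) renaming (map to Dec-map)
open import Relation.Nullary.Negation using (¬_; contradiction)
open import Relation.Binary.PropositionalEquality
  using (_≡_; _≢_; refl; sym; trans; cong; cong₂; subst; module ≡-Reasoning)
open import Algebra.Bundles using (CommutativeSemiring)

module ⇔ = Equivalence

private variable
  a b : Level
  A B : Set a
  p q : A → Bool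
  x y : A
  xs ys S S′ : List A

T-≡ᵇ : ∀ {m n} → T (m ≡ᵇ n) ⇔ m ≡ n
T-≡ᵇ {m} {n} = mk⇔ (≡ᵇ⇒≡ m n) (≡⇒≡ᵇ m n)

T-<ᵇ : ∀ {m n} → T (m <ᵇ n) ⇔ m < n
T-<ᵇ {m} {n} = mk⇔ (<ᵇ⇒< m n) <⇒<ᵇ

T-injective : ∀ {b c} → T b ⇔ T c → b ≡ c
T-injective {false} {false} _   = refl
T-injective {true}  {true}  _   = refl
T-injective {true}  {false} b⇔c = ⊥-elim (⇔.to b⇔c tt)
T-injective {false} {true}  b⇔c = ⊥-elim (⇔.from b⇔c tt)

T-not : ∀ {b} → T (not b) ⇔ (¬ T b)
T-not {false} = mk⇔ (λ _ ()) (λ _ → tt)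
T-not {true}  = mk⇔ (λ ()) (λ ¬t → ¬t tt)

T-not-∨ : ∀ {b c} → T (not b ∨ c) ⇔ (T b → T c)
T-not-∨ {false} = mk⇔ (λ _ ()) (λ _ → tt)
T-not-∨ {true}  = mk⇔ (λ t _ → t) (λ f → f tt)

T-if-else-true : ∀ {b c} → T (if b then c else true) ⇔ (T b → T c)
T-if-else-true {false} = mk⇔ (λ _ ()) (λ _ → tt)
T-if-else-true {true}  = mk⇔ (λ t _ → t) (λ f → f tt)

T-any : ∀ {P : A → Set b} → (∀ {x} → T (p x) ⇔ P x) → T (any p xs) ⇔ (∃[ x ] x ∈ xs × P x)
T-any T-p = mk⇔
  (map₂ (map₂ (⇔.to T-p)) ∘ find ∘ ⇔.from any⇔)
  (λ (_ , x∈xs , Px) → ⇔.to any⇔ (lose x∈xs (⇔.from T-p Px)))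

T-any-≡ : (_==_ : A → A → Bool) → (∀ {x y} → T (x == y) ⇔ x ≡ y) →
          T (any (x ==_) xs) ⇔ x ∈ xs
T-any-≡ {x = x} _==_ T-== = mk⇔
  (λ t → let _ , y∈xs , x≡y = ⇔.to any-== t in subst (_∈ _) (sym x≡y) y∈xs)
  (λ x∈xs → ⇔.from any-== (_ , x∈xs , refl))
  where
  any-== : T (any (x ==_) xs) ⇔ (∃[ y ] y ∈ xs × x ≡ y)
  any-== = T-any T-==

T-all : T (all p xs) ⇔ All (T ∘ p) xs
T-all {p = p} {xs = xs} = mk⇔ (all⁺ p xs) (all⁻ p)

∈-filterᵇ : x ∈ filterᵇ p xs ⇔ (x ∈ xs × T (p x))
∈-filterᵇ {p = p} = mk⇔ (∈-filter⁻ (T? ∘ p)) (λ (x∈xs , px) → ∈-filter⁺ (T? ∘ p) x∈xs px)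

filterᵇ-cong : (∀ {x} → x ∈ xs → T (p x) ⇔ T (q x)) → filterᵇ p xs ≡ filterᵇ q xs
filterᵇ-cong {xs = []} p⇔q = refl
filterᵇ-cong {xs = x ∷ xs} {p = p} {q = q} p⇔q
  with p x | q x | T-injective {p x} {q x} (p⇔q (here refl))
... | true  | true  | refl = cong (x ∷_) (filterᵇ-cong (p⇔q ∘ there))
... | false | false | refl = filterᵇ-cong (p⇔q ∘ there)

length-filterᵇ-split : ∀ (p q : A → Bool) xs →
  length (filterᵇ p xs) ≡
  length (filterᵇ (λ x → p x ∧ q x) xs) +ℕ length (filterᵇ (λ x → p x ∧ not (q x)) xs)
length-filterᵇ-split p q [] = refl
length-filterᵇ-split p q (x ∷ xs) with p x | q x
... | true  | true  = cong suc (length-filterᵇ-split p q xs)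
... | true  | false = trans (cong suc (length-filterᵇ-split p q xs)) (sym (+-suc _ _))
... | false | _     = length-filterᵇ-split p q xs

length-filterᵇ-mono : ∀ (p q : A → Bool) xs → (∀ {x} → x ∈ xs → T (p x) → T (q x)) →
  length (filterᵇ p xs) ≤ length (filterᵇ q xs)
length-filterᵇ-mono p q [] p⇒q = z≤n
length-filterᵇ-mono p q (x ∷ xs) p⇒q with p x in px | q x in qx
... | true  | true  = s≤s (length-filterᵇ-mono p q xs (p⇒q ∘ there))
... | false | true  = m≤n⇒m≤1+n (length-filterᵇ-mono p q xs (p⇒q ∘ there))
... | false | false = length-filterᵇ-mono p q xs (p⇒q ∘ there)
... | true  | false = ⊥-elim (subst T qx (p⇒q (here refl) (subst T (sym px) tt)))

length-filterᵇ-mono-< : ∀ (p q : A → Bool) xs → (∀ {x} → x ∈ xs → T (p x) → T (q x)) →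
  y ∈ xs → ¬ T (p y) → T (q y) → length (filterᵇ p xs) < length (filterᵇ q xs)
length-filterᵇ-mono-< p q (x ∷ xs) p⇒q (here refl) ¬py qy with p x | q x
... | true  | _     = contradiction tt ¬py
... | false | false = contradiction qy (λ ())
... | false | true  = s≤s (length-filterᵇ-mono p q xs (p⇒q ∘ there))
length-filterᵇ-mono-< p q (x ∷ xs) p⇒q (there y∈xs) ¬py qy with p x in px | q x in qx
... | true  | true  = s≤s (length-filterᵇ-mono-< p q xs (p⇒q ∘ there) y∈xs ¬py qy)
... | false | true  = m≤n⇒m≤1+n (length-filterᵇ-mono-< p q xs (p⇒q ∘ there) y∈xs ¬py qy)
... | false | false = length-filterᵇ-mono-< p q xs (p⇒q ∘ there) y∈xs ¬py qy
... | true  | false = ⊥-elim (subst T qx (p⇒q (here refl) (subst T (sym px) tt)))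

∈-sublists-∷⁻ : ∀ (x : A) xs → S ∈ sublists (x ∷ xs) →
                S ∈ sublists xs ⊎ ∃[ S₀ ] S₀ ∈ sublists xs × S ≡ x ∷ S₀
∈-sublists-∷⁻ x xs = Sum.map₂ map∷⁻ ∘ ∈-++⁻ (sublists xs)

sublists-⊆ : S ∈ sublists xs → S ⊆ xs
sublists-⊆ {xs = []} (here refl) ()
sublists-⊆ {xs = y ∷ xs} S∈ x∈S with ∈-sublists-∷⁻ y xs S∈ | x∈S
... | inj₁ S∈′              | x∈S′       = there (sublists-⊆ {xs = xs} S∈′ x∈S′)
... | inj₂ (_ , _ , refl)   | here refl  = here refl
... | inj₂ (_ , S₀∈ , refl) | there x∈S₀ = there (sublists-⊆ {xs = xs} S₀∈ x∈S₀)

∉-sublists : x ∉ xs → S ∈ sublists xs → x ∉ S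
∉-sublists x∉xs S∈ = x∉xs ∘ sublists-⊆ S∈

filterᵇ∈sublists : ∀ (p : A → Bool) xs → filterᵇ p xs ∈ sublists xs
filterᵇ∈sublists p [] = here refl
filterᵇ∈sublists p (x ∷ xs) with p x
... | true  = ∈-++⁺ʳ (sublists xs) (∈-map⁺ (x ∷_) (filterᵇ∈sublists p xs))
... | false = ∈-++⁺ˡ (filterᵇ∈sublists p xs)

sublists-unique : Unique xs → Unique (sublists xs)
sublists-unique [] = [] ∷ []
sublists-unique {xs = x ∷ xs} x∷xs!@(_ ∷ xs!) =
  Unique.++⁺ (sublists-unique xs!) (Unique.map⁺ ∷-injectiveʳ (sublists-unique xs!)) disjoint
  where
  disjoint : S ∈ sublists xs × S ∈ map (x ∷_) (sublists xs) → ⊥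
  disjoint (S∈ , S∈′) with _ , _ , refl ← map∷⁻ S∈′ =
    ∉-sublists (Unique.Unique[x∷xs]⇒x∉xs x∷xs!) S∈ (here refl)

unique-∈sublists : Unique xs → S ∈ sublists xs → Unique S
unique-∈sublists {xs = []} [] (here refl) = []
unique-∈sublists {xs = x ∷ xs} x∷xs!@(_ ∷ xs!) S∈ with ∈-sublists-∷⁻ x xs S∈
... | inj₁ S∈′ = unique-∈sublists xs! S∈′
... | inj₂ (_ , S₀∈ , refl) =
  All.tabulate (λ y∈ → λ { refl → ∉-sublists (Unique.Unique[x∷xs]⇒x∉xs x∷xs!) S₀∈ y∈ })
  ∷ unique-∈sublists xs! S₀∈

sublists-ext : Unique xs → S ∈ sublists xs → S′ ∈ sublists xs →
               (∀ {x} → x ∈ S ⇔ x ∈ S′) → S ≡ S′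
sublists-ext {xs = []} [] (here refl) (here refl) _ = refl
sublists-ext {xs = x ∷ xs} x∷xs!@(_ ∷ xs!) S∈ S′∈ S⇔S′
  with Unique.Unique[x∷xs]⇒x∉xs x∷xs! | ∈-sublists-∷⁻ x xs S∈ | ∈-sublists-∷⁻ x xs S′∈
... | _    | inj₁ S∈′ | inj₁ S′∈′ = sublists-ext xs! S∈′ S′∈′ S⇔S′
... | x∉xs | inj₁ S∈′ | inj₂ (_ , _ , refl) =
  contradiction (⇔.from S⇔S′ (here refl)) (∉-sublists x∉xs S∈′)
... | x∉xs | inj₂ (_ , _ , refl) | inj₁ S′∈′ =
  contradiction (⇔.to S⇔S′ (here refl)) (∉-sublists x∉xs S′∈′)
... | x∉xs | inj₂ (S₀ , S₀∈ , refl) | inj₂ (S₁ , S₁∈ , refl) =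
  cong (x ∷_) (sublists-ext xs! S₀∈ S₁∈ (mk⇔
    (λ y∈ → drop {T = S₁} S₀∈ y∈ (⇔.to S⇔S′ (there y∈)))
    (λ y∈ → drop {T = S₀} S₁∈ y∈ (⇔.from S⇔S′ (there y∈)))))
  where
  drop : ∀ {S T y} → S ∈ sublists xs → y ∈ S → y ∈ x ∷ T → y ∈ T
  drop S∈ y∈S (here refl) = contradiction y∈S (∉-sublists x∉xs S∈)
  drop _  _   (there y∈T) = y∈T

-- Reindexing sums along a bijection

map⁺-on : ∀ (f : A → B) → (∀ {x y} → x ∈ xs → y ∈ xs → f x ≡ f y → x ≡ y) →
          Unique xs → Unique (map f xs)
map⁺-on f inj [] = []
map⁺-on f inj (x∉xs ∷ xs!) =
  All-map⁺ (All.tabulate λ y∈xs fx≡fy → All.lookup x∉xs y∈xs (inj (here refl) (there y∈xs) fx≡fy))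
  ∷ map⁺-on f (λ x∈ y∈ → inj (there x∈) (there y∈)) xs!

unique-⇔⇒↭ : Unique xs → Unique ys → (∀ {x} → x ∈ xs ⇔ x ∈ ys) → xs ↭ ys
unique-⇔⇒↭ xs! ys! xs⇔ys = ∼bag⇒↭ (unique∧set⇒bag xs! ys! xs⇔ys)

record ListBijection {A : Set a} {B : Set b} (X : List A) (Y : List B) : Set (a ⊔ b) where
  field
    to      : A → B
    from    : B → A
    to-∈    : x ∈ X → to x ∈ Y
    from-∈  : y ∈ Y → from y ∈ X
    from-to : x ∈ X → from (to x) ≡ x
    to-from : y ∈ Y → to (from y) ≡ y

  to-injective : x ∈ X → y ∈ X → to x ≡ to y → x ≡ y
  to-injective x∈ y∈ tx≡ty = trans (sym (from-to x∈)) (trans (cong from tx≡ty) (from-to y∈))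

  map-to-↭ : Unique X → Unique Y → map to X ↭ Y
  map-to-↭ X! Y! = unique-⇔⇒↭ (map⁺-on to to-injective X!) Y! (mk⇔ image preimage)
    where
    image : y ∈ map to X → y ∈ Y
    image y∈ with _ , x∈ , refl ← ∈-map⁻ to y∈ = to-∈ x∈
    preimage : y ∈ Y → y ∈ map to X
    preimage y∈ = subst (_∈ map to X) (to-from y∈) (∈-map⁺ to (from-∈ y∈))

module _ {c ℓ} (R : CommutativeSemiring c ℓ) where
  open CommutativeSemiring R
    using (Carrier; _≈_; +-cong; setoid; isEquivalence; +-isCommutativeMonoid)
  module ≈ = CommutativeSemiring R using (refl; sym)
  open import Relation.Binary.Reasoning.Setoid setoid

  sumR-cong : ∀ {f g : A → Carrier} xs → (∀ {x} → x ∈ xs → f x ≈ g x) →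
              sumR R (map f xs) ≈ sumR R (map g xs)
  sumR-cong []       f≈g = ≈.refl
  sumR-cong (x ∷ xs) f≈g = +-cong (f≈g (here refl)) (sumR-cong xs (f≈g ∘ there))

  sumR-↭ : xs ↭ ys → sumR R xs ≈ sumR R ys
  sumR-↭ = PermutationSetoid.foldr-commMonoid setoid +-isCommutativeMonoid ∘ ↭⇒↭ₛ′ isEquivalence

  sumR-reindex : ∀ {X : List A} {Y : List B} (bij : ListBijection X Y) → Unique X → Unique Y →
    ∀ {f : A → Carrier} {g : B → Carrier} → (∀ {x} → x ∈ X → g (ListBijection.to bij x) ≈ f x) →
    sumR R (map f X) ≈ sumR R (map g Y)
  sumR-reindex {X = X} {Y} bij X! Y! {f} {g} g∘to≈f = begin
    sumR R (map f X)          ≈⟨ sumR-cong X (λ x∈ → ≈.sym (g∘to≈f x∈)) ⟩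
    sumR R (map (g ∘ to) X)   ≡⟨ cong (sumR R) (map-∘ X) ⟩
    sumR R (map g (map to X)) ≈⟨ sumR-↭ (↭-map⁺ g (map-to-↭ X! Y!)) ⟩
    sumR R (map g Y)          ∎
    where open ListBijection bij

-- Fillings of a set of cells

T-==ᶜ : ∀ {x y : Cell} → T (x ==ᶜ y) ⇔ x ≡ y
T-==ᶜ {t , c} {t′ , c′} = mk⇔
  (λ eq → let t≡ , c≡ = ⇔.to (T-∧ {t ≡ᵇ t′}) eq
          in  cong₂ _,_ (⇔.to T-≡ᵇ t≡) (⇔.to T-≡ᵇ c≡))
  (λ { refl → ⇔.from (T-∧ {t ≡ᵇ t}) (⇔.from (T-≡ᵇ {t}) refl , ⇔.from (T-≡ᵇ {c}) refl) })

T-∈ᶜ : ∀ {x : Cell} {P} → T (x ∈ᶜ P) ⇔ x ∈ P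
T-∈ᶜ = T-any-≡ _==ᶜ_ T-==ᶜ

-- Cells are (row , column): Below P x says that P has a cell strictly below x in its column, and
-- Crossed P x that the upward ray of one cell of P and the rightward ray of another meet at x.
Before : (along across : Cell → ℕ) → List Cell → Cell → Set
Before along across P x = ∃[ y ] y ∈ P × across y ≡ across x × along y < along x

Below Left Crossed : List Cell → Cell → Set
Below       = Before proj₁ proj₂
Left        = Before proj₂ proj₁
Crossed P x = Below P x × Left P x

T-before : ∀ along across {P x} →
  T (any (λ y → (across y ≡ᵇ across x) ∧ (along y <ᵇ along x)) P) ⇔ Before along across P x
T-before along across = T-any (mk⇔
  (λ t → let e , l = ⇔.to T-∧ t in ⇔.to T-≡ᵇ e , ⇔.to T-<ᵇ l)
  (λ (e , l) → ⇔.from T-∧ (⇔.from T-≡ᵇ e , ⇔.from T-<ᵇ l)))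

crossedᵇ : List Cell → Cell → Bool
crossedᵇ P x = pointedBelow P x ∧ pointedLeft P x

T-crossed : ∀ {P x} → T (crossedᵇ P x) ⇔ Crossed P x
T-crossed = mk⇔
  (λ t → let b , l = ⇔.to T-∧ t
         in  ⇔.to (T-before proj₁ proj₂) b , ⇔.to (T-before proj₂ proj₁) l)
  (λ (b , l) → ⇔.from T-∧ (⇔.from (T-before proj₁ proj₂) b ,
                           ⇔.from (T-before proj₂ proj₁) l))

crossed? : ∀ P x → Dec (Crossed P x)
crossed? P x = Dec-map T-crossed (T? (crossedᵇ P x))

before-mono : ∀ {along across P Q x} → P ⊆ Q → Before along across P x → Before along across Q x
before-mono P⊆Q (y , y∈P , same , before) = y , P⊆Q y∈P , same , before

crossed-mono : ∀ {P Q x} → P ⊆ Q → Crossed P x → Crossed Q x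
crossed-mono P⊆Q (b , l) = before-mono P⊆Q b , before-mono P⊆Q l

IsForest : List Cell → Set
IsForest P = ∀ {x} → x ∈ P → ¬ Crossed P x

T-condF1 : ∀ {P} → T (condF1 P) ⇔ IsForest P
T-condF1 = mk⇔
  (λ t {x} x∈P → ⇔.to T-not (All.lookup (⇔.to T-all t) x∈P) ∘ ⇔.from T-crossed)
  (λ forest → ⇔.from T-all (All.tabulate λ x∈P → ⇔.from T-not (forest x∈P ∘ ⇔.to T-crossed)))

module Fillings (C : List Cell) where

  Closed : List Cell → Set
  Closed E = ∀ {x} → x ∈ C → Crossed E x → x ∈ E

  closedᵇ : List Cell → Bool
  closedᵇ E = all (λ x → not (crossedᵇ E x) ∨ x ∈ᶜ E) C

  T-closed : ∀ {E} → T (closedᵇ E) ⇔ Closed E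
  T-closed = mk⇔
    (λ t {x} x∈C →
       ⇔.to T-∈ᶜ ∘ ⇔.to T-not-∨ (All.lookup (⇔.to T-all t) x∈C) ∘ ⇔.from T-crossed)
    (λ closed → ⇔.from T-all (All.tabulate λ x∈C →
       ⇔.from T-not-∨ (⇔.from T-∈ᶜ ∘ closed x∈C ∘ ⇔.to T-crossed)))

  closedFillings forestFillings : List (List Cell)
  closedFillings = filterᵇ closedᵇ (sublists C)
  forestFillings = filterᵇ condF1 (sublists C)

  ∈-closedFillings : ∀ {E} → E ∈ closedFillings ⇔ (E ∈ sublists C × Closed E)
  ∈-closedFillings = mk⇔ (map₂ (⇔.to T-closed) ∘ ⇔.to ∈-filterᵇ)
                         (⇔.from ∈-filterᵇ ∘ map₂ (⇔.from T-closed))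

  ∈-forestFillings : ∀ {P} → P ∈ forestFillings ⇔ (P ∈ sublists C × IsForest P)
  ∈-forestFillings = mk⇔ (map₂ (⇔.to T-condF1) ∘ ⇔.to ∈-filterᵇ)
                         (⇔.from ∈-filterᵇ ∘ map₂ (⇔.from T-condF1))

  crossingCount : List Cell → ℕ
  crossingCount P = length (filterᵇ (λ x → not (x ∈ᶜ P) ∧ crossedᵇ P x) C)

  pruned closure : List Cell → List Cell
  pruned E  = filterᵇ (λ x → x ∈ᶜ E ∧ not (crossedᵇ E x)) C
  closure P = filterᵇ (λ x → x ∈ᶜ P ∨ crossedᵇ P x) C

  ∈-pruned : ∀ {E x} → x ∈ pruned E ⇔ (x ∈ C × x ∈ E × ¬ Crossed E x)
  ∈-pruned {E} {x} = mk⇔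
    (λ x∈ → let x∈C , t = ⇔.to ∈-filterᵇ x∈ ; x∈E , ¬c = ⇔.to (T-∧ {x ∈ᶜ E}) t in
            x∈C , ⇔.to T-∈ᶜ x∈E , ⇔.to T-not ¬c ∘ ⇔.from T-crossed)
    (λ (x∈C , x∈E , ¬c) → ⇔.from ∈-filterᵇ
       (x∈C , ⇔.from T-∧ (⇔.from T-∈ᶜ x∈E , ⇔.from T-not (¬c ∘ ⇔.to T-crossed))))

  ∈-closure : ∀ {P x} → x ∈ closure P ⇔ (x ∈ C × (x ∈ P ⊎ Crossed P x))
  ∈-closure {P} {x} = mk⇔
    (λ x∈ → let x∈C , t = ⇔.to ∈-filterᵇ x∈ in
            x∈C , Sum.map (⇔.to T-∈ᶜ) (⇔.to T-crossed) (⇔.to (T-∨ {x ∈ᶜ P}) t))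
    (λ (x∈C , x∈P⊎c) → ⇔.from ∈-filterᵇ
       (x∈C , ⇔.from T-∨ (Sum.map (⇔.from T-∈ᶜ) (⇔.from T-crossed) x∈P⊎c)))

  pruned⊆ : ∀ {E} → pruned E ⊆ E
  pruned⊆ {E} = proj₁ ∘ proj₂ ∘ ⇔.to (∈-pruned {E})

  pruned-uncrossed : ∀ {E x} → x ∈ pruned E → ¬ Crossed E x
  pruned-uncrossed {E} = proj₂ ∘ proj₂ ∘ ⇔.to (∈-pruned {E})

  module Ray (along across : Cell → ℕ)
             (crossed⇒before : ∀ {P x} → Crossed P x → Before along across P x) where

    before-closure : ∀ {P x} → Before along across (closure P) x → Before along across P x
    before-closure (y , y∈ , same , y<x) with proj₂ (⇔.to ∈-closure y∈)
    ... | inj₁ y∈P = y , y∈P , same , y<x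
    ... | inj₂ crossed with z , z∈P , same′ , z<y ← crossed⇒before crossed =
      z , z∈P , trans same′ same , <-trans z<y y<x

    -- Walking along the line while the current cell is crossed ends at a cell that survives pruning.
    descend : ∀ {E y} → E ⊆ C → y ∈ E → Acc _<_ (along y) →
              ∃[ z ] z ∈ pruned E × across z ≡ across y × along z ≤ along y
    descend {E} {y} E⊆C y∈E (acc rs) with crossed? E y
    ... | no ¬c = y , ⇔.from ∈-pruned (E⊆C y∈E , y∈E , ¬c) , refl , ≤-refl
    ... | yes c with y′ , y′∈E , same , y′<y ← crossed⇒before c
                with z , z∈ , same′ , z≤y′ ← descend E⊆C y′∈E (rs y′<y) =
      z , z∈ , trans same′ same , ≤-trans z≤y′ (<⇒≤ y′<y)

    before-pruned : ∀ {E x} → E ⊆ C → Before along across E x → Before along across (pruned E) x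
    before-pruned E⊆C (y , y∈E , same , y<x) =
      let z , z∈ , same′ , z≤y = descend E⊆C y∈E (<-wellFounded (along y))
      in  z , z∈ , trans same′ same , ≤-<-trans z≤y y<x

  module Column = Ray proj₁ proj₂ proj₁
  module Row    = Ray proj₂ proj₁ proj₂

  crossed-closure : ∀ {P x} → Crossed (closure P) x → Crossed P x
  crossed-closure (b , l) = Column.before-closure b , Row.before-closure l

  crossed-pruned : ∀ {E x} → E ⊆ C → Crossed E x → Crossed (pruned E) x
  crossed-pruned E⊆C (b , l) = Column.before-pruned E⊆C b , Row.before-pruned E⊆C l

  pruned-isForest : ∀ {E} → IsForest (pruned E)
  pruned-isForest {E} x∈ = pruned-uncrossed {E} x∈ ∘ crossed-mono (pruned⊆ {E})

  closure-isClosed : ∀ {P} → Closed (closure P)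
  closure-isClosed {P} x∈C crossed = ⇔.from (∈-closure {P}) (x∈C , inj₂ (crossed-closure crossed))

  module _ (C! : Unique C) where

    filterᵇ-∈ᶜ : ∀ {E} → E ∈ sublists C → filterᵇ (_∈ᶜ E) C ≡ E
    filterᵇ-∈ᶜ {E} E∈ = sublists-ext C! (filterᵇ∈sublists (_∈ᶜ E) C) E∈ (mk⇔
      (λ x∈ → ⇔.to T-∈ᶜ (proj₂ (⇔.to ∈-filter-∈ᶜ x∈)))
      (λ x∈E → ⇔.from ∈-filter-∈ᶜ (sublists-⊆ E∈ x∈E , ⇔.from (T-∈ᶜ {P = E}) x∈E)))
      where
      ∈-filter-∈ᶜ : ∀ {x} → x ∈ filterᵇ (_∈ᶜ E) C ⇔ (x ∈ C × T (x ∈ᶜ E))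
      ∈-filter-∈ᶜ = ∈-filterᵇ

    closure-pruned : ∀ {E} → E ∈ sublists C → Closed E → closure (pruned E) ≡ E
    closure-pruned {E} E∈ closed = sublists-ext C! (filterᵇ∈sublists _ C) E∈ (mk⇔ to from)
      where
      to : ∀ {x} → x ∈ closure (pruned E) → x ∈ E
      to x∈ with ⇔.to ∈-closure x∈
      ... | _   , inj₁ x∈pruned = pruned⊆ {E} x∈pruned
      ... | x∈C , inj₂ crossed  = closed x∈C (crossed-mono (pruned⊆ {E}) crossed)
      from : ∀ {x} → x ∈ E → x ∈ closure (pruned E)
      from {x} x∈E with x∈C ← sublists-⊆ E∈ x∈E | crossed? E x
      ... | yes c = ⇔.from ∈-closure (x∈C , inj₂ (crossed-pruned (sublists-⊆ E∈) c))
      ... | no ¬c = ⇔.from ∈-closure (x∈C , inj₁ (⇔.from ∈-pruned (x∈C , x∈E , ¬c)))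

    pruned-closure : ∀ {P} → P ∈ sublists C → IsForest P → pruned (closure P) ≡ P
    pruned-closure {P} P∈ forest = sublists-ext C! (filterᵇ∈sublists _ C) P∈ (mk⇔ to from)
      where
      P⊆closure : P ⊆ closure P
      P⊆closure y∈P = ⇔.from ∈-closure (sublists-⊆ P∈ y∈P , inj₁ y∈P)
      to : ∀ {x} → x ∈ pruned (closure P) → x ∈ P
      to x∈ with _ , x∈closure , ¬c ← ⇔.to ∈-pruned x∈ | ⇔.to ∈-closure x∈closure
      ... | _ , inj₁ x∈P     = x∈P
      ... | _ , inj₂ crossed = contradiction (crossed-mono P⊆closure crossed) ¬c
      from : ∀ {x} → x ∈ P → x ∈ pruned (closure P)
      from x∈P =
        ⇔.from ∈-pruned (sublists-⊆ P∈ x∈P , P⊆closure x∈P , forest x∈P ∘ crossed-closure)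

    pruning : ListBijection closedFillings forestFillings
    pruning = record
      { to      = pruned
      ; from    = closure
      ; to-∈    = λ {E} _ → ⇔.from ∈-forestFillings (filterᵇ∈sublists _ C , pruned-isForest {E})
      ; from-∈  = λ {P} _ → ⇔.from ∈-closedFillings (filterᵇ∈sublists _ C , closure-isClosed {P})
      ; from-to = λ E∈ → let E∈′ , closed = ⇔.to ∈-closedFillings E∈ in
                          closure-pruned E∈′ closed
      ; to-from = λ P∈ → let P∈′ , forest = ⇔.to ∈-forestFillings P∈ in
                          pruned-closure P∈′ forest
      }

    -- The cells pruned from a closed filling are exactly the crossing cells of what remains.
    length-pruned : ∀ {E} → E ∈ closedFillings →
                    length (pruned E) +ℕ crossingCount (pruned E) ≡ length E
    length-pruned {E} E∈ = begin
      length (pruned E) +ℕ crossingCount (pruned E)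
        ≡⟨ +-comm (length (pruned E)) _ ⟩
      crossingCount (pruned E) +ℕ length (pruned E)
        ≡⟨ cong (λ L → length L +ℕ length (pruned E)) (filterᵇ-cong crossed⇔crossing) ⟨
      length (filterᵇ (λ x → x ∈ᶜ E ∧ crossedᵇ E x) C) +ℕ length (pruned E)
        ≡⟨ length-filterᵇ-split (_∈ᶜ E) (crossedᵇ E) C ⟨
      length (filterᵇ (_∈ᶜ E) C)
        ≡⟨ cong length (filterᵇ-∈ᶜ E∈′) ⟩
      length E ∎
      where
      open ≡-Reasoning
      E∈′ : E ∈ sublists C
      E∈′ = proj₁ (⇔.to ∈-closedFillings E∈)
      closed : Closed E
      closed = proj₂ (⇔.to ∈-closedFillings E∈)
      crossed⇔crossing : ∀ {x} → x ∈ C →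
        T (x ∈ᶜ E ∧ crossedᵇ E x) ⇔ T (not (x ∈ᶜ pruned E) ∧ crossedᵇ (pruned E) x)
      crossed⇔crossing {x} x∈C = mk⇔
        (λ t → let x∈E , c = ⇔.to (T-∧ {x ∈ᶜ E}) t ; c = ⇔.to T-crossed c in
           ⇔.from T-∧ (⇔.from T-not (λ x∈p → pruned-uncrossed {E} (⇔.to T-∈ᶜ x∈p) c) ,
                       ⇔.from T-crossed (crossed-pruned (sublists-⊆ E∈′) c)))
        (λ t → let _ , c = ⇔.to (T-∧ {not (x ∈ᶜ pruned E)}) t
                   c = crossed-mono (pruned⊆ {E}) (⇔.to T-crossed c) in
           ⇔.from T-∧ (⇔.from T-∈ᶜ (closed x∈C c) , ⇔.from T-crossed c))

cellsFrom-rows : ∀ {t ls x} → x ∈ cellsFrom t ls → t ≤ proj₁ x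
cellsFrom-rows {t} {l ∷ ls} x∈ with ∈-++⁻ (map (λ c → (t , suc c)) (upTo l)) x∈
... | inj₁ x∈row with _ , _ , refl ← ∈-map⁻ (λ c → (t , suc c)) x∈row = ≤-refl
... | inj₂ x∈rest = <⇒≤ (cellsFrom-rows {ls = ls} x∈rest)

cellsFrom-unique : ∀ t ls → Unique (cellsFrom t ls)
cellsFrom-unique t [] = []
cellsFrom-unique t (l ∷ ls) =
  Unique.++⁺ (Unique.map⁺ (λ { refl → refl }) (Unique.upTo⁺ l)) (cellsFrom-unique (suc t) ls) disjoint
  where
  disjoint : ∀ {x} → x ∈ map (λ c → (t , suc c)) (upTo l) × x ∈ cellsFrom (suc t) ls → ⊥
  disjoint (x∈row , x∈rest) with _ , _ , refl ← ∈-map⁻ (λ c → (t , suc c)) x∈row =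
    <-irrefl refl (cellsFrom-rows {ls = ls} x∈rest)

module _ {n : ℕ} where

  T-<ᶠ : ∀ {i j : Fin n} → T (i <ᶠ j) ⇔ toℕ i < toℕ j
  T-<ᶠ {i} {j} = T-<ᵇ {toℕ i} {toℕ j}

  <ᶠ-irrefl : ∀ {i : Fin n} → ¬ T (i <ᶠ i)
  <ᶠ-irrefl {i} = <-irrefl refl ∘ ⇔.to (T-<ᶠ {i} {i})

  T-==ᶠ : ∀ {i j : Fin n} → T (i ==ᶠ j) ⇔ i ≡ j
  T-==ᶠ {i} {j} = mk⇔ (toℕ-injective ∘ ⇔.to T-≡ᵇ)
                      (⇔.from (T-≡ᵇ {toℕ i} {toℕ j}) ∘ cong toℕ)

  T-==ᵉ : ∀ {e f : Edge n} → T (e ==ᵉ f) ⇔ e ≡ f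
  T-==ᵉ {i , j} {k , l} = mk⇔
    (λ eq → let i≡ , j≡ = ⇔.to (T-∧ {i ==ᶠ k}) eq
            in  cong₂ _,_ (⇔.to T-==ᶠ i≡) (⇔.to T-==ᶠ j≡))
    (λ { refl → ⇔.from T-∧ (⇔.from (T-==ᶠ {i}) refl , ⇔.from (T-==ᶠ {j}) refl) })

  T-∈ᵉ : ∀ {e : Edge n} {E} → T (e ∈ᵉ E) ⇔ e ∈ E
  T-∈ᵉ = T-any-≡ _==ᵉ_ T-==ᵉ

  ≢-on-<⇒injective : ∀ {P : Fin n → Set} (f : Fin n → ℕ) →
    (∀ {a b} → P a → P b → toℕ a < toℕ b → f a ≢ f b) →
    ∀ {a b} → P a → P b → f a ≡ f b → a ≡ b
  ≢-on-<⇒injective f separated {a} {b} Pa Pb fa≡fb with <-cmp (toℕ a) (toℕ b)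
  ... | tri< a<b _ _ = contradiction fa≡fb (separated Pa Pb a<b)
  ... | tri≈ _ a≡b _ = toℕ-injective a≡b
  ... | tri> _ _ b<a = contradiction (sym fa≡fb) (separated Pb Pa b<a)

  Increasing Decreasing : List (Fin n) → Set
  Increasing = AllPairs (λ i j → toℕ i < toℕ j)
  Decreasing = AllPairs (λ i j → toℕ j < toℕ i)

  allFin-increasing : Increasing (allFin n)
  allFin-increasing = AllPairs.tabulate⁺-< (λ i<j → i<j)

  reverse-decreasing : ∀ {L} → Increasing L → Decreasing (reverse L)
  reverse-decreasing [] = []
  reverse-decreasing {i ∷ L} (i<L ∷ L↑) = subst Decreasing (sym (unfold-reverse i L))
    (AllPairs.++⁺ (reverse-decreasing L↑) ([] ∷ [])
                  (All.tabulate λ j∈ → All.lookup i<L (reverse⁻ j∈) ∷ []))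

  select : ∀ (p : Fin n → Bool) {L} → Increasing L → ∀ j {m} →
    m < length (filterᵇ (λ k → p k ∧ (k <ᶠ j)) L) →
    ∃[ b ] b ∈ L × T (p b) × toℕ b < toℕ j × length (filterᵇ (λ k → p k ∧ (k <ᶠ b)) L) ≡ m
  select p {a ∷ L} (a<L ∷ L↑) j {m} m< with p a ∧ (a <ᶠ j) in a-counted | m
  ... | true | zero =
    let pa , a<j = ⇔.to (T-∧ {p a}) (⇔.from T-≡ a-counted) in
    a , here refl , pa , ⇔.to (T-<ᶠ {a}) a<j ,
    cong length (filter-none (T? ∘ λ k → p k ∧ (k <ᶠ a)) {xs = a ∷ L} none-below)
    where
    none-below : All (λ k → ¬ T (p k ∧ (k <ᶠ a))) (a ∷ L)
    none-below = (<ᶠ-irrefl {a} ∘ proj₂ ∘ ⇔.to (T-∧ {p a}))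
               ∷ All.map (λ {k} a<k → <-asym a<k ∘ ⇔.to (T-<ᶠ {k}) ∘ proj₂ ∘ ⇔.to (T-∧ {p k}))
                         a<L
  ... | true | suc m′ with b , b∈L , pb , b<j , count≡ ← select p L↑ j (≤-pred m<) =
    b , there b∈L , pb , b<j ,
    trans (cong length (filter-accept (T? ∘ λ k → p k ∧ (k <ᶠ b)) {x = a} {xs = L} a-below))
          (cong suc count≡)
    where
    a-below : T (p a ∧ (a <ᶠ b))
    a-below = ⇔.from T-∧ (proj₁ (⇔.to (T-∧ {p a}) (⇔.from T-≡ a-counted)) ,
                          ⇔.from (T-<ᶠ {a}) (All.lookup a<L b∈L))
  ... | false | _ with b , b∈L , pb , b<j , count≡ ← select p L↑ j m< =
    b , there b∈L , pb , b<j ,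
    trans (cong length (filter-reject (T? ∘ λ k → p k ∧ (k <ᶠ b)) {x = a} {xs = L} a-not-below)) count≡
    where
    a-not-below : ¬ T (p a ∧ (a <ᶠ b))
    a-not-below t = subst T a-counted (⇔.from T-∧ (proj₁ (⇔.to (T-∧ {p a}) t) ,
                                                   ⇔.from (T-<ᶠ {a} {j}) (<-trans (All.lookup a<L b∈L) b<j)))

  rank : List (Fin n) → Fin n → ℕ
  rank L j = length (filterᵇ (j <ᶠ_) L)

  rank-head : ∀ {j L} → Decreasing (j ∷ L) → rank (j ∷ L) j ≡ 0
  rank-head {j} {L} (L<j ∷ _) = cong length (filter-none (T? ∘ (j <ᶠ_)) {xs = j ∷ L}
    (<ᶠ-irrefl {j} ∷ All.map (λ {k} k<j → <-asym k<j ∘ ⇔.to (T-<ᶠ {j} {k})) L<j))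

  rank-tail : ∀ {j j′ L} → Decreasing (j ∷ L) → j′ ∈ L → rank (j ∷ L) j′ ≡ suc (rank L j′)
  rank-tail {j} {j′} {L} (L<j ∷ _) j′∈L = cong length
    (filter-accept (T? ∘ (j′ <ᶠ_)) {x = j} {xs = L} (⇔.from (T-<ᶠ {j′} {j}) (All.lookup L<j j′∈L)))

  -- The entries of a decreasing L index the rows of cellsFrom t (map g L), the larger ones lower.
  ∈-cellsFrom : ∀ (g : Fin n → ℕ) {t L x} → Decreasing L →
    x ∈ cellsFrom t (map g L) ⇔ (∃[ j ] ∃[ m ] j ∈ L × m < g j × x ≡ (t +ℕ rank L j , suc m))
  ∈-cellsFrom g {t} {[]} [] = mk⇔ (λ ()) (λ ())
  ∈-cellsFrom g {t} {j ∷ L} {x} L↓@(_ ∷ L↓′) = mk⇔ to from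
    where
    ih : ∀ {y} → y ∈ cellsFrom (suc t) (map g L) ⇔
                 (∃[ j′ ] ∃[ m ] j′ ∈ L × m < g j′ × y ≡ (suc t +ℕ rank L j′ , suc m))
    ih = ∈-cellsFrom g L↓′
    bottom : List Cell
    bottom = map (λ c → (t , suc c)) (upTo (g j))
    row-j : t +ℕ rank (j ∷ L) j ≡ t
    row-j = trans (cong (t +ℕ_) (rank-head L↓)) (+-identityʳ t)
    row-L : ∀ {j′} → j′ ∈ L → t +ℕ rank (j ∷ L) j′ ≡ suc t +ℕ rank L j′
    row-L j′∈L = trans (cong (t +ℕ_) (rank-tail L↓ j′∈L)) (+-suc t _)
    to : x ∈ cellsFrom t (map g (j ∷ L)) → _
    to x∈ with ∈-++⁻ bottom x∈
    ... | inj₁ x∈bottom with m , m∈ , refl ← ∈-map⁻ _ x∈bottom =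
      j , m , here refl , ∈-upTo⁻ m∈ , cong (_, suc m) (sym row-j)
    ... | inj₂ x∈rest with j′ , m , j′∈L , m< , refl ← ⇔.to ih x∈rest =
      j′ , m , there j′∈L , m< , cong (_, suc m) (sym (row-L j′∈L))
    from : _ → x ∈ cellsFrom t (map g (j ∷ L))
    from (_ , m , here refl , m< , refl) =
      ∈-++⁺ˡ (subst (_∈ bottom) (cong (_, suc m) (sym row-j))
                    (∈-map⁺ (λ c → (t , suc c)) (∈-upTo⁺ m<)))
    from (j′ , m , there j′∈L , m< , refl) =
      ∈-++⁺ʳ bottom (⇔.from ih (j′ , m , j′∈L , m< , cong (_, suc m) (row-L j′∈L)))

  pairsFrom : Fin n → List (Edge n)
  pairsFrom i = map (i ,_) (filterᵇ (i <ᶠ_) (allFin n))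

  pairsFrom-ordered : ∀ {i e} → e ∈ pairsFrom i → toℕ (proj₁ e) < toℕ (proj₂ e)
  pairsFrom-ordered {i} e∈ with j , j∈ , refl ← ∈-map⁻ (i ,_) e∈ =
    ⇔.to (T-<ᶠ {i} {j}) (proj₂ (⇔.to (∈-filterᵇ {p = i <ᶠ_} {xs = allFin n}) j∈))

  ∈-allPairs : ∀ {i j : Fin n} → (i , j) ∈ allPairs n ⇔ toℕ i < toℕ j
  ∈-allPairs {i} {j} = mk⇔
    (λ ij∈ → pairsFrom-ordered (proj₂ (proj₂ (find (∈-concatMap⁻ pairsFrom {xs = allFin n} ij∈)))))
    (λ i<j → ∈-concatMap⁺ pairsFrom
      (lose (∈-allFin i) (∈-map⁺ (i ,_) (⇔.from ∈-filterᵇ (∈-allFin j , ⇔.from (T-<ᶠ {i}) i<j)))))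

  allPairs-unique : Unique (allPairs n)
  allPairs-unique = Unique.concat⁺
    (All-map⁺ (All.tabulate λ _ →
      Unique.map⁺ (λ { refl → refl }) (Unique.filter⁺ _ (Unique.allFin⁺ n))))
    (AllPairs.map⁺ (AllPairs-map disjoint (Unique.allFin⁺ n)))
    where
    disjoint : ∀ {i i′} → i ≢ i′ → ∀ {e} → e ∈ pairsFrom i × e ∈ pairsFrom i′ → ⊥
    disjoint i≢i′ (e∈ , e∈′)
      with _ , _ , refl ← ∈-map⁻ _ e∈ | _ , _ , refl ← ∈-map⁻ _ e∈′ = i≢i′ refl

  B1 : List (Edge n) → Set
  B1 E = ∀ {i j k l} → (i , k) ∈ E → (j , l) ∈ E →
         toℕ i < toℕ j → toℕ j < toℕ k → toℕ k < toℕ l → (j , k) ∈ E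

  T-condB1 : ∀ {E} → T (condB1 E) ⇔ B1 E
  T-condB1 {E} = mk⇔
    (λ t {i} {j} {k} {l} ik∈ jl∈ i<j j<k k<l →
      ⇔.to T-∈ᵉ (⇔.to T-if-else-true (All.lookup (⇔.to T-all (All.lookup (⇔.to T-all t) ik∈)) jl∈)
        (⇔.from T-∧ (⇔.from (T-<ᶠ {i} {j}) i<j ,
                     ⇔.from T-∧ (⇔.from (T-<ᶠ {j} {k}) j<k , ⇔.from (T-<ᶠ {k} {l}) k<l)))))
    (λ b1 → ⇔.from (T-all {xs = E}) (All.tabulate λ {(i , k)} ik∈ →
            ⇔.from (T-all {xs = E}) (All.tabulate λ {(j , l)} jl∈ →
      ⇔.from T-if-else-true λ t →
        let i<j , t′ = ⇔.to (T-∧ {i <ᶠ j}) t ; j<k , k<l = ⇔.to (T-∧ {j <ᶠ k}) t′ in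
        ⇔.from T-∈ᵉ (b1 ik∈ jl∈ (⇔.to (T-<ᶠ {i}) i<j) (⇔.to (T-<ᶠ {j}) j<k)
                                (⇔.to (T-<ᶠ {k}) k<l)))))

-- The diagram λ(ε)

module Diagram {n : ℕ} (ε : Vec Bool n) where

  Positive Negative : Fin n → Set
  Positive i = T (lookup ε i)
  Negative j = T (not (lookup ε j))

  Compatible : Edge n → Set
  Compatible (i , j) = Positive i × Negative j × toℕ i < toℕ j

  negatives↓ : List (Fin n)
  negatives↓ = reverse (negPositions ε)

  ∈-negatives↓ : ∀ {j} → j ∈ negatives↓ ⇔ Negative j
  ∈-negatives↓ {j} = mk⇔
    (proj₂ ∘ ⇔.to ∈-negPositions ∘ reverse⁻)
    (λ neg → reverse⁺ (⇔.from ∈-negPositions (∈-allFin j , neg)))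
    where
    ∈-negPositions : j ∈ negPositions ε ⇔ (j ∈ allFin n × Negative j)
    ∈-negPositions = ∈-filterᵇ

  -- Sink j labels row 1 + #{negative k > j} of λ(ε) and source i labels column 1 + #{positive k < i}.
  row col : Fin n → ℕ
  row j = suc (rank negatives↓ j)
  col i = suc (plusBefore ε i)

  cells-unique : Unique (cells ε)
  cells-unique = cellsFrom-unique 1 (shape ε)

  cellOf : Edge n → Cell
  cellOf (i , j) = row j , col i

  negatives↓-decreasing : Decreasing negatives↓
  negatives↓-decreasing = reverse-decreasing (AllPairs.filter⁺ _ allFin-increasing)

  cells≡staircase : cells ε ≡ cellsFrom 1 (map (plusBefore ε) negatives↓)
  cells≡staircase = cong (cellsFrom 1) (sym (reverse-map (plusBefore ε) (negPositions ε)))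

  ∈-cells : ∀ {x} → x ∈ cells ε ⇔
            (∃[ j ] ∃[ m ] Negative j × m < plusBefore ε j × x ≡ (row j , suc m))
  ∈-cells rewrite cells≡staircase = mk⇔
    (λ x∈ → let j , m , j∈ , m< , x≡ = ⇔.to staircase x∈
            in  j , m , ⇔.to ∈-negatives↓ j∈ , m< , x≡)
    (λ (j , m , neg , m< , x≡) → ⇔.from staircase (j , m , ⇔.from ∈-negatives↓ neg , m< , x≡))
    where
    staircase : ∀ {x} → x ∈ cellsFrom 1 (map (plusBefore ε) negatives↓) ⇔
                (∃[ j ] ∃[ m ] j ∈ negatives↓ × m < plusBefore ε j × x ≡ (row j , suc m))
    staircase = ∈-cellsFrom (plusBefore ε) negatives↓-decreasing

  positiveBelow : Fin n → Fin n → Bool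
  positiveBelow i k = lookup ε k ∧ (k <ᶠ i)

  plusBefore-mono : ∀ {a b} → toℕ a ≤ toℕ b → plusBefore ε a ≤ plusBefore ε b
  plusBefore-mono {a} {b} a≤b =
    length-filterᵇ-mono (positiveBelow a) (positiveBelow b) (allFin n) λ {k} _ t →
      let pos , k<a = ⇔.to (T-∧ {lookup ε k}) t
      in  ⇔.from T-∧ (pos , ⇔.from (T-<ᶠ {i = k} {b}) (<-≤-trans (⇔.to (T-<ᶠ {i = k} {a}) k<a) a≤b))

  plusBefore-mono-< : ∀ {a b} → Positive a → toℕ a < toℕ b → plusBefore ε a < plusBefore ε b
  plusBefore-mono-< {a} {b} pos a<b =
    length-filterᵇ-mono-< (positiveBelow a) (positiveBelow b) (allFin n)
    (λ {k} _ t → let pos , k<a = ⇔.to (T-∧ {lookup ε k}) t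
                 in  ⇔.from T-∧ (pos , ⇔.from (T-<ᶠ {i = k} {b})
                                              (<-trans (⇔.to (T-<ᶠ {i = k} {a}) k<a) a<b)))
    (∈-allFin a) (<ᶠ-irrefl {i = a} ∘ proj₂ ∘ ⇔.to (T-∧ {lookup ε a}))
    (⇔.from T-∧ (pos , ⇔.from (T-<ᶠ {i = a} {b}) a<b))

  rank-antitone : ∀ {c d} → toℕ c ≤ toℕ d → rank negatives↓ d ≤ rank negatives↓ c
  rank-antitone {c} {d} c≤d = length-filterᵇ-mono (d <ᶠ_) (c <ᶠ_) negatives↓ λ {k} _ d<k →
    ⇔.from (T-<ᶠ {i = c} {k}) (≤-<-trans c≤d (⇔.to (T-<ᶠ {i = d} {k}) d<k))

  rank-antitone-< : ∀ {c d} → Negative d → toℕ c < toℕ d → rank negatives↓ d < rank negatives↓ c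
  rank-antitone-< {c} {d} neg c<d = length-filterᵇ-mono-< (d <ᶠ_) (c <ᶠ_) negatives↓
    (λ {k} _ d<k → ⇔.from (T-<ᶠ {i = c} {k}) (<-trans c<d (⇔.to (T-<ᶠ {i = d} {k}) d<k)))
    (⇔.from ∈-negatives↓ neg) (<ᶠ-irrefl {i = d}) (⇔.from (T-<ᶠ {i = c} {d}) c<d)

  col-< : ∀ {a b} → Positive a → toℕ a < toℕ b → col a < col b
  col-< pos a<b = s≤s (plusBefore-mono-< pos a<b)

  row-< : ∀ {c d} → Negative d → toℕ c < toℕ d → row d < row c
  row-< neg c<d = s≤s (rank-antitone-< neg c<d)

  col-<⁻ : ∀ {a b} → col a < col b → toℕ a < toℕ b
  col-<⁻ {a} {b} ca<cb with toℕ a <? toℕ b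
  ... | yes a<b = a<b
  ... | no  a≮b = contradiction (s≤s (plusBefore-mono (≮⇒≥ a≮b))) (<⇒≱ ca<cb)

  row-<⁻ : ∀ {c d} → row d < row c → toℕ c < toℕ d
  row-<⁻ {c} {d} rd<rc with toℕ c <? toℕ d
  ... | yes c<d = c<d
  ... | no  c≮d = contradiction (s≤s (rank-antitone (≮⇒≥ c≮d))) (<⇒≱ rd<rc)

  col-injective : ∀ {a b} → Positive a → Positive b → col a ≡ col b → a ≡ b
  col-injective = ≢-on-<⇒injective col λ pos _ a<b → >⇒≢ (col-< pos a<b) ∘ sym

  row-injective : ∀ {c d} → Negative c → Negative d → row c ≡ row d → c ≡ d
  row-injective = ≢-on-<⇒injective row λ _ neg c<d → >⇒≢ (row-< neg c<d)

  cellOf-injective : ∀ {e e′} → Compatible e → Compatible e′ → cellOf e ≡ cellOf e′ → e ≡ e′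
  cellOf-injective (pos , neg , _) (pos′ , neg′ , _) same =
    cong₂ _,_ (col-injective pos pos′ (cong proj₂ same)) (row-injective neg neg′ (cong proj₁ same))

  cellOf∈cells : ∀ {e} → Compatible e → cellOf e ∈ cells ε
  cellOf∈cells {i , j} (pos , neg , i<j) =
    ⇔.from ∈-cells (j , plusBefore ε i , neg , plusBefore-mono-< pos i<j , refl)

  cells⊆cellOf : ∀ {x} → x ∈ cells ε → ∃[ e ] Compatible e × cellOf e ≡ x
  cells⊆cellOf x∈ with j , m , neg , m< , refl ← ⇔.to ∈-cells x∈
                  with b , _ , pos , b<j , count≡ ← select (lookup ε) allFin-increasing j m< =
    (b , j) , (pos , neg , b<j) , cong (λ k → row j , suc k) count≡

-- Networks as closed fillings of λ(ε)

module Transport {n : ℕ} (ε : Vec Bool n) where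
  open Diagram ε
  open Fillings (cells ε)

  Signed : Edge n → Set
  Signed (i , j) = Positive i × Negative j

  T-signCond : ∀ {E} → T (signCond ε E) ⇔ All Signed E
  T-signCond = mk⇔ (All.map (⇔.to T-∧) ∘ ⇔.to T-all) (⇔.from T-all ∘ All.map (⇔.from T-∧))

  signed⇒noPath : ∀ {E} → All Signed E → T (noPath E)
  signed⇒noPath {E} signed =
    ⇔.from (T-all {xs = E}) (All.tabulate λ e∈ → ⇔.from (T-all {xs = E}) (All.tabulate λ f∈ →
      ⇔.from T-not λ sink≡source → ⇔.to T-not (proj₂ (All.lookup signed e∈))
        (subst Positive (sym (⇔.to T-==ᶠ sink≡source)) (proj₁ (All.lookup signed f∈)))))

  ∈-networks : ∀ {S} → S ∈ networks ε ⇔ (S ∈ sublists (allPairs n) × B1 S × All Signed S)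
  ∈-networks {S} = mk⇔
    (λ S∈ → let S∈′ , t = ⇔.to ∈-filterᵇ S∈ ; _ , t′ = ⇔.to (T-∧ {noPath S}) t
                b1 , signed = ⇔.to (T-∧ {condB1 S}) t′
            in  S∈′ , (λ {i j k l} → ⇔.to T-condB1 b1 {i} {j} {k} {l}) , ⇔.to T-signCond signed)
    (λ (S∈′ , b1 , signed) → ⇔.from ∈-filterᵇ
       (S∈′ , ⇔.from T-∧ (signed⇒noPath signed ,
                          ⇔.from T-∧ (⇔.from T-condB1 b1 , ⇔.from T-signCond signed))))

  network-compatible : ∀ {S e} → S ∈ networks ε → e ∈ S → Compatible e
  network-compatible S∈ e∈ =
    let pos , neg = All.lookup (proj₂ (proj₂ (⇔.to ∈-networks S∈))) e∈
    in  pos , neg , ⇔.to ∈-allPairs (sublists-⊆ (proj₁ (⇔.to ∈-networks S∈)) e∈)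

  toCells : List (Edge n) → List Cell
  toCells S = filterᵇ (_∈ᶜ map cellOf S) (cells ε)

  toEdges : List Cell → List (Edge n)
  toEdges E =
    filterᵇ (λ e → (lookup ε (proj₁ e) ∧ not (lookup ε (proj₂ e))) ∧ cellOf e ∈ᶜ E) (allPairs n)

  ∈-toCells : ∀ S {x} → x ∈ toCells S ⇔ (x ∈ cells ε × x ∈ map cellOf S)
  ∈-toCells S = mk⇔ (map₂ (⇔.to T-∈ᶜ) ∘ ⇔.to ∈-filterᵇ)
                    (⇔.from (∈-filterᵇ {p = _∈ᶜ map cellOf S}) ∘ map₂ (⇔.from T-∈ᶜ))

  ∈-toEdges : ∀ E {e} → e ∈ toEdges E ⇔ (Compatible e × cellOf e ∈ E)
  ∈-toEdges E {i , j} = mk⇔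
    (λ e∈ → let e∈′ , t    = ⇔.to ∈-filterᵇ e∈
                signed , c∈ = ⇔.to (T-∧ {lookup ε i ∧ not (lookup ε j)}) t
                pos , neg   = ⇔.to (T-∧ {lookup ε i}) signed
            in  (pos , neg , ⇔.to ∈-allPairs e∈′) , ⇔.to T-∈ᶜ c∈)
    (λ ((pos , neg , i<j) , c∈) → ⇔.from ∈-filterᵇ
       (⇔.from ∈-allPairs i<j , ⇔.from T-∧ (⇔.from T-∧ (pos , neg) , ⇔.from (T-∈ᶜ {P = E}) c∈)))

  toCells-closed : ∀ {S} → S ∈ networks ε → Closed (toCells S)
  toCells-closed {S} S∈ x∈C (below , left)
    with (b , c) , (pos-b , neg-c , b<c) , refl ← cells⊆cellOf x∈C
    with y , y∈ , same-col , lower ← below | z , z∈ , same-row , leftward ← left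
    with (b′ , d) , bd∈S , refl ← ∈-map⁻ cellOf (proj₂ (⇔.to (∈-toCells S) y∈))
       | (a , c′) , ac∈S , refl ← ∈-map⁻ cellOf (proj₂ (⇔.to (∈-toCells S) z∈))
    with refl ← col-injective (proj₁ (network-compatible S∈ bd∈S)) pos-b same-col
       | refl ← row-injective (proj₁ (proj₂ (network-compatible S∈ ac∈S))) neg-c same-row =
    ⇔.from (∈-toCells S) (x∈C , ∈-map⁺ cellOf bc∈S)
    where
    bc∈S : (b , c) ∈ S
    bc∈S = proj₁ (proj₂ (⇔.to ∈-networks S∈)) ac∈S bd∈S (col-<⁻ leftward) b<c (row-<⁻ lower)

  toEdges-network : ∀ {E} → E ∈ closedFillings → toEdges E ∈ networks ε
  toEdges-network {E} E∈ = ⇔.from ∈-networks (filterᵇ∈sublists _ (allPairs n) , b1 , signed)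
    where
    closed : Closed E
    closed = proj₂ (⇔.to ∈-closedFillings E∈)
    b1 : B1 (toEdges E)
    b1 {_} {b} {c} ac∈ bd∈ a<b b<c c<d
      with (pos-a , neg-c , _) , ac∈E ← ⇔.to (∈-toEdges E) ac∈
         | (pos-b , neg-d , _) , bd∈E ← ⇔.to (∈-toEdges E) bd∈ =
      ⇔.from (∈-toEdges E) (bc , closed (cellOf∈cells bc)
        ((_ , bd∈E , refl , row-< neg-d c<d) , (_ , ac∈E , refl , col-< pos-a a<b)))
      where
      bc : Compatible (b , c)
      bc = pos-b , neg-c , b<c
    signed : All Signed (toEdges E)
    signed = All.tabulate λ e∈ → let (pos , neg , _) , _ = ⇔.to (∈-toEdges E) e∈ in pos , neg

  toEdges-toCells : ∀ {S} → S ∈ networks ε → toEdges (toCells S) ≡ S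
  toEdges-toCells {S} S∈ =
    sublists-ext allPairs-unique (filterᵇ∈sublists _ (allPairs n)) (proj₁ (⇔.to ∈-networks S∈))
                 (mk⇔ to from)
    where
    to : ∀ {e} → e ∈ toEdges (toCells S) → e ∈ S
    to e∈ with compatible , c∈ ← ⇔.to (∈-toEdges (toCells S)) e∈
          with e′ , e′∈S , same ← ∈-map⁻ cellOf (proj₂ (⇔.to (∈-toCells S) c∈)) =
      subst (_∈ S) (sym (cellOf-injective compatible (network-compatible S∈ e′∈S) same)) e′∈S
    from : ∀ {e} → e ∈ S → e ∈ toEdges (toCells S)
    from e∈ = let compatible = network-compatible S∈ e∈ in
      ⇔.from (∈-toEdges (toCells S))
             (compatible , ⇔.from (∈-toCells S) (cellOf∈cells compatible , ∈-map⁺ cellOf e∈))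

  toCells-toEdges : ∀ {E} → E ∈ closedFillings → toCells (toEdges E) ≡ E
  toCells-toEdges {E} E∈ =
    sublists-ext cells-unique (filterᵇ∈sublists _ (cells ε)) E∈′ (mk⇔ to from)
    where
    E∈′ : E ∈ sublists (cells ε)
    E∈′ = proj₁ (⇔.to ∈-closedFillings E∈)
    to : ∀ {x} → x ∈ toCells (toEdges E) → x ∈ E
    to x∈ with e , e∈ , refl ← ∈-map⁻ cellOf (proj₂ (⇔.to (∈-toCells (toEdges E)) x∈)) =
      proj₂ (⇔.to (∈-toEdges E) e∈)
    from : ∀ {x} → x ∈ E → x ∈ toCells (toEdges E)
    from x∈E with x∈C ← sublists-⊆ E∈′ x∈E with e , compatible , refl ← cells⊆cellOf x∈C =
      ⇔.from (∈-toCells (toEdges E))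
             (x∈C , ∈-map⁺ cellOf (⇔.from (∈-toEdges E) (compatible , x∈E)))

  transport : ListBijection (networks ε) closedFillings
  transport = record
    { to      = toCells
    ; from    = toEdges
    ; to-∈    = λ S∈ → ⇔.from ∈-closedFillings (filterᵇ∈sublists _ (cells ε) , toCells-closed S∈)
    ; from-∈  = toEdges-network
    ; from-to = toEdges-toCells
    ; to-from = toCells-toEdges
    }

  length-toCells : ∀ {S} → S ∈ networks ε → length (toCells S) ≡ length S
  length-toCells {S} S∈ = begin
    length (toCells S)     ≡⟨ ↭-length (unique-⇔⇒↭ toCells! cellOf[S]! (mk⇔ to from)) ⟩
    length (map cellOf S)  ≡⟨ length-map cellOf S ⟩
    length S               ∎
    where
    open ≡-Reasoning
    toCells! : Unique (toCells S)
    toCells! = Unique.filter⁺ _ cells-unique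
    cellOf[S]! : Unique (map cellOf S)
    cellOf[S]! = map⁺-on cellOf
      (λ e∈ e′∈ → cellOf-injective (network-compatible S∈ e∈) (network-compatible S∈ e′∈))
      (unique-∈sublists allPairs-unique (proj₁ (⇔.to ∈-networks S∈)))
    to : ∀ {x} → x ∈ toCells S → x ∈ map cellOf S
    to = proj₂ ∘ ⇔.to (∈-toCells S)
    from : ∀ {x} → x ∈ map cellOf S → x ∈ toCells S
    from x∈ with e , e∈ , refl ← ∈-map⁻ cellOf x∈ =
      ⇔.from (∈-toCells S) (cellOf∈cells (network-compatible S∈ e∈) , x∈)

theorem4p19 : ∀ {c ℓ : Level} (R : CommutativeSemiring c ℓ) (n : ℕ) (ε : Vec Bool (suc n))
    → head ε ≡ true → last ε ≡ false
    → ∀ (q : CommutativeSemiring.Carrier R)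
    → CommutativeSemiring._≈_ R (W R ε q) (F R ε q)
theorem4p19 R n ε _ _ q = begin
  W R ε q
    ≈⟨ sumR-reindex R transport networks! closedFillings!
         (reflexive ∘ cong (pow R q) ∘ length-toCells) ⟩
  sumR R (map (λ E → pow R q (length E)) closedFillings)
    ≈⟨ sumR-reindex R (pruning cells-unique) closedFillings! forests!
         (reflexive ∘ cong (pow R q) ∘ length-pruned cells-unique) ⟩
  F R ε q ∎
  where
  open Diagram ε using (cells-unique)
  open Transport ε
  open Fillings (cells ε)
  open CommutativeSemiring R using (reflexive; setoid)
  open import Relation.Binary.Reasoning.Setoid setoid
  networks! : Unique (networks ε)
  networks! = Unique.filter⁺ _ (sublists-unique allPairs-unique)
  closedFillings! : Unique closedFillings
  closedFillings! = Unique.filter⁺ _ (sublists-unique cells-unique)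
  forests! : Unique (forests ε)
  forests! = Unique.filter⁺ _ (sublists-unique cells-unique)
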